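{- Let $G$ be a graph, $U\subseteq V(G)$, and let $v$ be an end vertex of a path $P_4$ (on $4$ vertices, disjoint from $G$). Let $H$ be the graph with $V(H)=V(G)\cup V(P_4)$ and $E(H)=E(G)\cup E(P_4)\cup\{uv:u\in U\}$. Then, for any $\ell\ge 2$, $\overline{H}$ is $N$-AW if and only if $\overline{G\cup P_4}$ is $N$-AW.
   Context: All graphs are finite and simple; labels lie in $\mathbb{Z}_\ell$. In the neighborhood Lights Out game on a graph $G$, each vertex carries a label in $\mathbb{Z}_\ell$; toggling a vertex $v$ adds $1$ (mod $\ell$) to the label of every vertex of the closed neighborhood $N[v]$; the game is won when all labels are $0$. $G$ is $N$-AW if the game can be won from every initial labeling. $\cup$ denotes disjoint union and $\overline{\,\cdot\,}$ complement. -}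

module Defs where

open import Data.Nat using (ℕ; zero; suc; _+_)
open import Data.Nat.Divisibility using (_∣_)
open import Data.Fin using (Fin; zero; suc; splitAt; _≟_)
open import Data.Bool using (Bool; true; false; not; if_then_else_)
open import Data.Sum using (_⊎_; inj₁; inj₂)
open import Data.Product using (_×_; ∃)
open import Relation.Nullary using (does)
open import Relation.Binary.PropositionalEquality using (_≡_)

Adj : ℕ → Set
Adj n = Fin n → Fin n → Bool

IsSimple : ∀ {n} → Adj n → Set
IsSimple {n} A = (∀ (u v : Fin n) → A u v ≡ A v u) × (∀ (u : Fin n) → A u u ≡ false)

compl : ∀ {n} → Adj n → Adj n
compl A u v = if does (u ≟ v) then false else not (A u v)

inN : ∀ {n} → Adj n → Fin n → Fin n → Bool
inN A v w = if does (v ≟ w) then true else A v w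

sumFin : ∀ n → (Fin n → ℕ) → ℕ
sumFin zero    f = 0
sumFin (suc n) f = f zero + sumFin n (λ i → f (suc i))

-- Label of w after toggling each vertex v exactly x v times, from labelling b.
after : ∀ {n} → Adj n → (Fin n → ℕ) → (Fin n → ℕ) → Fin n → ℕ
after {n} A b x w = b w + sumFin n (λ v → if inN A v w then x v else 0)

-- Neighbourhood Lights Out over ℤ_ℓ: the game is winnable from labelling b
-- (labels are natural numbers read modulo ℓ; toggle counts also naturals).
Winnable : ∀ {n} → ℕ → Adj n → (Fin n → ℕ) → Set
Winnable {n} ℓ A b = ∃ λ (x : Fin n → ℕ) → ∀ (w : Fin n) → ℓ ∣ after A b x w

NAW : ∀ {n} → ℕ → Adj n → Set
NAW {n} ℓ A = ∀ (b : Fin n → ℕ) → Winnable ℓ A b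

p4 : Adj 4
p4 zero (suc zero) = true
p4 (suc zero) zero = true
p4 (suc zero) (suc (suc zero)) = true
p4 (suc (suc zero)) (suc zero) = true
p4 (suc (suc zero)) (suc (suc (suc zero))) = true
p4 (suc (suc (suc zero))) (suc (suc zero)) = true
p4 _ _ = false

-- H: disjoint union of G (vertices Fin n, embedded first) and P4 (last 4
-- vertices), plus edges uv for u ∈ U, where v is the end vertex 0 of P4.
hAdj' : ∀ {n} → Adj n → (Fin n → Bool) → Fin n ⊎ Fin 4 → Fin n ⊎ Fin 4 → Bool
hAdj' G U (inj₁ a) (inj₁ b) = G a b
hAdj' G U (inj₂ i) (inj₂ j) = p4 i j
hAdj' G U (inj₁ a) (inj₂ zero) = U a
hAdj' G U (inj₂ zero) (inj₁ a) = U a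
hAdj' G U _ _ = false

H : ∀ {n} → Adj n → (Fin n → Bool) → Adj (n + 4)
H {n} G U u w = hAdj' G U (splitAt n u) (splitAt n w)

GuP4 : ∀ {n} → Adj n → Adj (n + 4)
GuP4 G = H G (λ _ → false)

-- In the complement of H, for every U, the closed neighbourhood of p₃ is that of p₁ plus p₀;
-- so in any solution the labels at p₁ and p₃ force the number of toggles at p₀ to be
-- b(p₁) − b(p₃) modulo ℓ. The complements of H and of G ∪ P₄ differ only in the edges
-- between U and p₀. Hence a solution of one game, started from b shifted by ±(b(p₁) − b(p₃))
-- on U, solves the other game from b up to an error ±Σ_{u ∈ U} x(u) at p₀; toggling p₁ that
-- many times and p₃ minus that many times changes the label of p₀ alone and removes the error.
module Submission where

open import Defs
open import Data.Nat using (ℕ; zero; suc; _+_; _*_; _%_; _≥_; s≤s)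
open import Data.Nat.Properties using (+-assoc; +-identityʳ; *-identityˡ; *-comm; +-commutativeSemigroup)
open import Algebra.Properties.CommutativeSemigroup +-commutativeSemigroup using (interchange)
open import Data.Nat.DivMod using (%-distribˡ-+; %-distribˡ-*; [m+kn]%n≡m%n)
open import Data.Nat.Divisibility using (_∣_; m%n≡0⇒n∣m; n∣m⇒m%n≡0)
open import Data.Nat.Tactic.RingSolver using (solve-∀)
open import Data.Fin using (Fin; zero; suc; splitAt; join; _↑ˡ_; _↑ʳ_; _≟_)
open import Data.Fin.Properties using (splitAt-join; join-splitAt; +↔⊎)
open import Data.Bool using (Bool; true; false; not; if_then_else_)
open import Data.Sum using (_⊎_; inj₁; inj₂)
open import Data.Sum.Properties using (≡-dec)
open import Data.Product using (_×_; _,_; ∃)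
open import Function using (_∘_; mk⇔; Injection)
open import Function.Properties.Inverse using (↔⇒↣)
open import Relation.Nullary using (does)
open import Relation.Nullary.Decidable using (does-⇔)
open import Relation.Binary.Bundles using (Setoid)
open import Relation.Binary.Definitions using (DecidableEquality)
open import Relation.Binary.PropositionalEquality

sumFin-cong : ∀ n {f g : Fin n → ℕ} → (∀ i → f i ≡ g i) → sumFin n f ≡ sumFin n g
sumFin-cong zero    f≗g = refl
sumFin-cong (suc n) f≗g = cong₂ _+_ (f≗g zero) (sumFin-cong n (f≗g ∘ suc))

sumFin-zero : ∀ n → sumFin n (λ _ → 0) ≡ 0
sumFin-zero zero    = refl
sumFin-zero (suc n) = sumFin-zero n

sumFin-+ : ∀ n (f g : Fin n → ℕ) → sumFin n (λ i → f i + g i) ≡ sumFin n f + sumFin n g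
sumFin-+ zero    f g = refl
sumFin-+ (suc n) f g rewrite sumFin-+ n (f ∘ suc) (g ∘ suc) =
  interchange (f zero) (g zero) (sumFin n (f ∘ suc)) (sumFin n (g ∘ suc))

sumFin-↑ : ∀ m k (f : Fin (m + k) → ℕ) →
           sumFin (m + k) f ≡ sumFin m (λ i → f (i ↑ˡ k)) + sumFin k (λ j → f (m ↑ʳ j))
sumFin-↑ zero    k f = refl
sumFin-↑ (suc m) k f rewrite sumFin-↑ m k (f ∘ suc) = sym (+-assoc (f zero) _ _)

Vertex : ℕ → Set
Vertex n = Fin n ⊎ Fin 4

pattern p₀ = inj₂ zero
pattern p₁ = inj₂ (suc zero)
pattern p₂ = inj₂ (suc (suc zero))
pattern p₃ = inj₂ (suc (suc (suc zero)))

_≟ᵥ_ : ∀ {n} → DecidableEquality (Vertex n)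
_≟ᵥ_ = ≡-dec _≟_ _≟_

sumV : ∀ {n} → (Vertex n → ℕ) → ℕ
sumV {n} f = sumFin n (f ∘ inj₁) + sumFin 4 (f ∘ inj₂)

sumV-cong : ∀ {n} {f g : Vertex n → ℕ} → (∀ s → f s ≡ g s) → sumV f ≡ sumV g
sumV-cong {n} f≗g = cong₂ _+_ (sumFin-cong n (f≗g ∘ inj₁)) (sumFin-cong 4 (f≗g ∘ inj₂))

sumV-+ : ∀ {n} (f g : Vertex n → ℕ) → sumV (λ s → f s + g s) ≡ sumV f + sumV g
sumV-+ {n} f g = trans (cong₂ _+_ (sumFin-+ n (f ∘ inj₁) (g ∘ inj₁)) (sumFin-+ 4 (f ∘ inj₂) (g ∘ inj₂)))
                       (interchange (sumFin n (f ∘ inj₁)) _ _ _)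

if-+ : ∀ (c : Bool) a b → (if c then a + b else 0) ≡ (if c then a else 0) + (if c then b else 0)
if-+ true  a b = refl
if-+ false a b = refl

if-0 : ∀ (c : Bool) → (if c then 0 else 0) ≡ 0
if-0 true  = refl
if-0 false = refl

sumFin-if-0 : ∀ n (c : Fin n → Bool) → sumFin n (λ i → if c i then 0 else 0) ≡ 0
sumFin-if-0 n c = trans (sumFin-cong n (if-0 ∘ c)) (sumFin-zero n)

if-not+if : ∀ (c : Bool) a → (if not c then a else 0) + (if c then a else 0) ≡ a
if-not+if true  a = refl
if-not+if false a = +-identityʳ a

∅ : ∀ {n} → Fin n → Bool
∅ _ = false

indW : ∀ {n} → (Fin n → Bool) → Vertex n → ℕ
indW W (inj₁ a) = if W a then 1 else 0
indW W (inj₂ _) = 0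

indP₀ : ∀ {n} → Vertex n → ℕ
indP₀ p₀ = 1
indP₀ _  = 0

sumOn : ∀ {n} → (Fin n → Bool) → (Vertex n → ℕ) → ℕ
sumOn {n} W y = sumFin n (λ a → if W a then y (inj₁ a) else 0)

crossEffect : ∀ {n} → (Fin n → Bool) → (Vertex n → ℕ) → Vertex n → ℕ
crossEffect W y t = indW W t * y p₀ + indP₀ t * sumOn W y

module _ {n : ℕ} (G : Adj n) where

  inNᶜ : (Fin n → Bool) → Vertex n → Vertex n → Bool
  inNᶜ U s t = if does (s ≟ᵥ t) then true else not (hAdj' G U s t)

  effect : (Fin n → Bool) → (Vertex n → ℕ) → Vertex n → ℕ
  effect U y t = sumV (λ s → if inNᶜ U s t then y s else 0)

  does-splitAt : ∀ (v w : Fin (n + 4)) → does (v ≟ w) ≡ does (splitAt n v ≟ᵥ splitAt n w)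
  does-splitAt v w =
    does-⇔ (mk⇔ (cong (splitAt n)) (Injection.injective (↔⇒↣ +↔⊎))) (v ≟ w) (splitAt n v ≟ᵥ splitAt n w)

  inN-compl-H : ∀ U (v w : Fin (n + 4)) → inN (compl (H G U)) v w ≡ inNᶜ U (splitAt n v) (splitAt n w)
  inN-compl-H U v w rewrite does-splitAt v w with does (splitAt n v ≟ᵥ splitAt n w)
  ... | true  = refl
  ... | false = refl

  after-compl-H : ∀ U b x (w : Fin (n + 4)) →
                  after (compl (H G U)) b x w ≡ b w + effect U (x ∘ join n 4) (splitAt n w)
  after-compl-H U b x w = cong (b w +_) (trans (sumFin-↑ n 4 _) (sumV-cong λ s →
    cong (λ c → if c then x (join n 4 s) else 0)
         (trans (inN-compl-H U (join n 4 s) w) (cong (λ r → inNᶜ U r (splitAt n w)) (splitAt-join n 4 s)))))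

  effect-cong : ∀ U {y y' : Vertex n → ℕ} → (∀ s → y s ≡ y' s) → ∀ t → effect U y t ≡ effect U y' t
  effect-cong U y≗y' t = sumV-cong λ s → cong (λ k → if inNᶜ U s t then k else 0) (y≗y' s)

  effect-+ : ∀ U (y y' : Vertex n → ℕ) t → effect U (λ s → y s + y' s) t ≡ effect U y t + effect U y' t
  effect-+ U y y' t = trans (sumV-cong λ s → if-+ (inNᶜ U s t) (y s) (y' s))
                            (sumV-+ (λ s → if inNᶜ U s t then y s else 0) (λ s → if inNᶜ U s t then y' s else 0))

  Solvable : ℕ → (Fin n → Bool) → Set
  Solvable ℓ U = ∀ (b : Vertex n → ℕ) → ∃ λ y → ∀ t → ℓ ∣ b t + effect U y t

  NAW⇒Solvable : ∀ {ℓ} U → NAW ℓ (compl (H G U)) → Solvable ℓ U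
  NAW⇒Solvable {ℓ} U naw b with naw (b ∘ splitAt n)
  ... | x , solves = x ∘ join n 4 , λ t →
    subst (λ r → ℓ ∣ b r + effect U (x ∘ join n 4) r) (splitAt-join n 4 t)
          (subst (ℓ ∣_) (after-compl-H U (b ∘ splitAt n) x (join n 4 t)) (solves (join n 4 t)))

  Solvable⇒NAW : ∀ {ℓ} U → Solvable ℓ U → NAW ℓ (compl (H G U))
  Solvable⇒NAW {ℓ} U solvable b with solvable (b ∘ join n 4)
  ... | y , solves = y ∘ splitAt n , λ w → subst (ℓ ∣_)
    (sym (trans (after-compl-H U b (y ∘ splitAt n) w)
                (cong₂ _+_ (cong b (sym (join-splitAt n 4 w)))
                           (effect-cong U (cong y ∘ splitAt-join n 4) (splitAt n w)))))
    (solves (splitAt n w))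

  effect-p₃ : ∀ U y → effect U y p₃ ≡ effect U y p₁ + y p₀
  effect-p₃ U y = rearrange (sumFin n (y ∘ inj₁)) (y p₀) (y p₁) (y p₃)
    where
    rearrange : ∀ g a b c → g + (a + (b + (0 + (c + 0)))) ≡ g + (0 + (b + (0 + (c + 0)))) + a
    rearrange = solve-∀

  effect-∅ : ∀ W y t → effect ∅ y t ≡ effect W y t + crossEffect W y t
  effect-∅ W y (inj₁ a) with W a
  ... | true  = rearrange (sumFin n (λ b → if inNᶜ W (inj₁ b) (inj₁ a) then y (inj₁ b) else 0)) (y p₀) _
    where
    rearrange : ∀ g a r → g + (a + r) ≡ g + (0 + r) + ((a + 0) + 0)
    rearrange = solve-∀
  ... | false = sym (+-identityʳ _)
  effect-∅ W y p₀ = trans (cong (_+ path) split) (rearrange off (sumOn W y) path)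
    where
    off path : ℕ
    off = sumFin n (λ a → if not (W a) then y (inj₁ a) else 0)
    path = sumFin 4 (λ j → if inNᶜ W (inj₂ j) p₀ then y (inj₂ j) else 0)
    split : sumFin n (y ∘ inj₁) ≡ off + sumOn W y
    split = trans (sumFin-cong n λ a → sym (if-not+if (W a) (y (inj₁ a)))) (sumFin-+ n _ _)
    rearrange : ∀ a b r → a + b + r ≡ a + r + (b + 0)
    rearrange = solve-∀
  effect-∅ W y (inj₂ (suc k)) = sym (+-identityʳ _)

-- Congruence modulo suc m, in which m * k serves as − k.
module Modulo (m : ℕ) where

  infix 4 _≈_
  record _≈_ (a b : ℕ) : Set where
    constructor mod-≡
    field %-≡ : a % suc m ≡ b % suc m
  open _≈_

  ≈-setoid : Setoid _ _
  ≈-setoid = record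
    { _≈_           = _≈_
    ; isEquivalence = record
      { refl  = mod-≡ refl
      ; sym   = λ a≈b → mod-≡ (sym (%-≡ a≈b))
      ; trans = λ a≈b b≈c → mod-≡ (trans (%-≡ a≈b) (%-≡ b≈c))
      }
    }

  open Setoid ≈-setoid public using () renaming (refl to ≈-refl; sym to ≈-sym; trans to ≈-trans)

  +-cong-≈ : ∀ {a a' b b'} → a ≈ a' → b ≈ b' → a + b ≈ a' + b'
  +-cong-≈ {a} {a'} {b} {b'} (mod-≡ a≈a') (mod-≡ b≈b') = mod-≡ (begin
    (a + b) % suc m                   ≡⟨ %-distribˡ-+ a b (suc m) ⟩
    (a % suc m + b % suc m) % suc m   ≡⟨ cong₂ (λ x y → (x + y) % suc m) a≈a' b≈b' ⟩
    (a' % suc m + b' % suc m) % suc m ≡⟨ %-distribˡ-+ a' b' (suc m) ⟨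
    (a' + b') % suc m                 ∎)
    where open ≡-Reasoning

  +-congˡ-≈ : ∀ a {b b'} → b ≈ b' → a + b ≈ a + b'
  +-congˡ-≈ a = +-cong-≈ ≈-refl

  +-congʳ-≈ : ∀ {a a'} → a ≈ a' → ∀ b → a + b ≈ a' + b
  +-congʳ-≈ a≈a' b = +-cong-≈ a≈a' ≈-refl

  *-congˡ-≈ : ∀ σ {a a'} → a ≈ a' → σ * a ≈ σ * a'
  *-congˡ-≈ σ {a} {a'} (mod-≡ a≈a') = mod-≡ (begin
    (σ * a) % suc m                    ≡⟨ %-distribˡ-* σ a (suc m) ⟩
    (σ % suc m * (a % suc m)) % suc m  ≡⟨ cong (λ x → (σ % suc m * x) % suc m) a≈a' ⟩
    (σ % suc m * (a' % suc m)) % suc m ≡⟨ %-distribˡ-* σ a' (suc m) ⟨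
    (σ * a') % suc m                   ∎)
    where open ≡-Reasoning

  +-multiple-≈ : ∀ a k → a + k * suc m ≈ a
  +-multiple-≈ a k = mod-≡ ([m+kn]%n≡m%n a k (suc m))

  +-neg-≈ : ∀ k → k + m * k ≈ 0
  +-neg-≈ k = mod-≡ (trans (cong (_% suc m) (*-comm (suc m) k)) (%-≡ (+-multiple-≈ 0 k)))

  ∣⇒≈0 : ∀ {a} → suc m ∣ a → a ≈ 0
  ∣⇒≈0 = mod-≡ ∘ n∣m⇒m%n≡0 _ (suc m)

  ≈0⇒∣ : ∀ {a} → a ≈ 0 → suc m ∣ a
  ≈0⇒∣ = m%n≡0⇒n∣m _ (suc m) ∘ %-≡

  ≈-difference : ∀ {a b e z} → a + e ≈ 0 → b + (e + z) ≈ 0 → z ≈ a + m * b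
  ≈-difference {a} {b} {e} {z} a+e≈0 b+e+z≈0 = ≈-sym (begin
    a + m * b                            ≈⟨ +-multiple-≈ (a + m * b) (e + z) ⟨
    a + m * b + (e + z) * suc m          ≡⟨ regroup m a b e z ⟩
    z + (a + e) + m * (b + (e + z))      ≈⟨ +-cong-≈ (+-cong-≈ ≈-refl a+e≈0) (*-congˡ-≈ m b+e+z≈0) ⟩
    z + 0 + m * 0                        ≡⟨ regroup-0 m z ⟩
    z                                    ∎)
    where
    open import Relation.Binary.Reasoning.Setoid ≈-setoid
    regroup : ∀ k a b e z → a + k * b + (e + z) * suc k ≡ z + (a + e) + k * (b + (e + z))
    regroup = solve-∀
    regroup-0 : ∀ k z → z + 0 + k * 0 ≡ z
    regroup-0 = solve-∀

  pulse : ∀ {n} → ℕ → Vertex n → ℕ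
  pulse k p₁ = k
  pulse k p₃ = m * k
  pulse k _  = 0

  module _ {n : ℕ} (G : Adj n) where

    effect-pulse : ∀ U k t → effect G U (pulse k) t + indP₀ t * k ≈ 0
    effect-pulse U k t =
      subst (λ g → g + onPath t + indP₀ t * k ≈ 0) (sym (sumFin-if-0 n λ a → inNᶜ G U (inj₁ a) t)) (pulse-path t)
      where
      onPath : Vertex n → ℕ
      onPath t = sumFin 4 (λ j → if inNᶜ G U (inj₂ j) t then pulse {n} k (inj₂ j) else 0)
      cancels : ∀ k j → k + (j + 0) + 0 ≡ k + j
      cancels = solve-∀
      cancels-p₀ : ∀ k j → j + 0 + (k + 0) ≡ k + j
      cancels-p₀ = solve-∀
      negated : ∀ {a} → a ≡ k + m * k → a ≈ 0
      negated a≡k-k = subst (_≈ 0) (sym a≡k-k) (+-neg-≈ k)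
      pulse-path : ∀ t → onPath t + indP₀ t * k ≈ 0
      pulse-path (inj₁ a) with U a
      ... | true    = negated (cancels k (m * k))
      ... | false   = negated (cancels k (m * k))
      pulse-path p₀ = negated (cancels-p₀ k (m * k))
      pulse-path p₁ = negated (cancels k (m * k))
      pulse-path p₂ = ≈-refl
      pulse-path p₃ = negated (cancels k (m * k))

    Twisted : (S T W : Fin n → Bool) → ℕ → Set
    Twisted S T W σ = ∀ y t → effect G T y t ≈ effect G S y t + σ * crossEffect W y t

    transfer : ∀ {S T} W σ → Twisted S T W σ → Solvable G (suc m) S → Solvable G (suc m) T
    transfer {S} {T} W σ twisted solvable b with solvable (λ t → b t + indW W t * (σ * (b p₁ + m * b p₃)))
    ... | z , z-solves = x , λ t → ≈0⇒∣ (begin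
      b t + effect G T x t                                ≡⟨ cong (b t +_) (effect-+ G T z (pulse c) t) ⟩
      b t + (effect G T z t + effect G T (pulse c) t)     ≈⟨ +-congˡ-≈ (b t) (+-congʳ-≈ (twisted z t) _) ⟩
      b t + (effect G S z t + σ * crossEffect W z t + effect G T (pulse c) t)
                                                          ≡⟨ regroup (b t) (effect G S z t) σ (indW W t) (z p₀) (indP₀ t) (sumOn W z) _ ⟩
      b t + indW W t * (σ * z p₀) + effect G S z t + (effect G T (pulse c) t + indP₀ t * c)
                                                          ≈⟨ +-cong-≈ (z-solved t) (effect-pulse T c t) ⟩
      0 ∎)
      where
      open import Relation.Binary.Reasoning.Setoid ≈-setoid
      d c : ℕ
      d = b p₁ + m * b p₃
      c = σ * sumOn W z
      x : Vertex n → ℕ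
      x s = z s + pulse c s
      regroup : ∀ b e σ f a g c p → b + (e + σ * (f * a + g * c) + p) ≡ b + f * (σ * a) + e + (p + g * (σ * c))
      regroup = solve-∀
      z-solved : ∀ t → b t + indW W t * (σ * z p₀) + effect G S z t ≈ 0
      z-solved t = ≈-trans (+-congʳ-≈ (+-congˡ-≈ (b t) (*-congˡ-≈ (indW W t) (*-congˡ-≈ σ z-p₀))) _)
                           (∣⇒≈0 (z-solves t))
        where
        z-p₀ : z p₀ ≈ d
        z-p₀ = ≈-difference
          (∣⇒≈0 (subst (λ a → suc m ∣ a + effect G S z p₁) (+-identityʳ (b p₁)) (z-solves p₁)))
          (∣⇒≈0 (subst₂ (λ a e → suc m ∣ a + e) (+-identityʳ (b p₃)) (effect-p₃ G S z) (z-solves p₃)))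

    twisted-removing : ∀ W → Twisted W ∅ W 1
    twisted-removing W y t = mod-≡ (cong (_% suc m)
      (trans (effect-∅ G W y t) (cong (effect G W y t +_) (sym (*-identityˡ _)))))

    twisted-adding : ∀ W → Twisted ∅ W W m
    twisted-adding W y t = ≈-sym (begin
      effect G ∅ y t + m * cross                ≡⟨ cong (_+ m * cross) (effect-∅ G W y t) ⟩
      effect G W y t + cross + m * cross        ≡⟨ +-assoc (effect G W y t) cross (m * cross) ⟩
      effect G W y t + (cross + m * cross)      ≈⟨ +-congˡ-≈ (effect G W y t) (+-neg-≈ cross) ⟩
      effect G W y t + 0                        ≡⟨ +-identityʳ _ ⟩
      effect G W y t                            ∎)
      where
      open import Relation.Binary.Reasoning.Setoid ≈-setoid
      cross : ℕ
      cross = crossEffect W y t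

    NAW-H⇒NAW-GuP4 : ∀ U → NAW (suc m) (compl (H G U)) → NAW (suc m) (compl (GuP4 G))
    NAW-H⇒NAW-GuP4 U = Solvable⇒NAW G ∅ ∘ transfer U 1 (twisted-removing U) ∘ NAW⇒Solvable G U

    NAW-GuP4⇒NAW-H : ∀ U → NAW (suc m) (compl (GuP4 G)) → NAW (suc m) (compl (H G U))
    NAW-GuP4⇒NAW-H U = Solvable⇒NAW G U ∘ transfer U m (twisted-adding U) ∘ NAW⇒Solvable G ∅

theorem3p1 : ∀ (ℓ : ℕ) → ℓ ≥ 2 → ∀ (n : ℕ) (G : Adj n) → IsSimple G → (U : Fin n → Bool) →
    (NAW ℓ (compl (H G U)) → NAW ℓ (compl (GuP4 G))) × (NAW ℓ (compl (GuP4 G)) → NAW ℓ (compl (H G U)))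
theorem3p1 (suc m) (s≤s _) n G _ U = NAW-H⇒NAW-GuP4 G U , NAW-GuP4⇒NAW-H G U
  where open Modulo m
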